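{- Let $\mathbf{k}$ be a commutative ring, $q\in\mathbf{k}$, $s$ a positive integer and $J\subseteq[s-1]$. Then \[(q+1)^sL_J=\sum_{I\subseteq[s-1]}(-1)^{|I|}(-q)^{|I\setminus J|}\eta^{(q)}_I.\]
   Context: Let $x_1,x_2,\dots$ be commuting indeterminates. For $J\subseteq[s-1]$, $L_J=\sum x_{i_1}\cdots x_{i_s}$ over $i_1\le\cdots\le i_s$ with $j\in J\Rightarrow i_j<i_{j+1}$ (Gessel's fundamental quasisymmetric function), and for $I\subseteq[s-1]$, $\eta^{(q)}_I=\sum(q+1)^{|\{i_1,\dots,i_s\}|}x_{i_1}\cdots x_{i_s}$ over $i_1\le\cdots\le i_s$ with $j\in I\Rightarrow i_j=i_{j+1}$ (sums over sequences of positive integers, in $\mathbf{k}[[x_1,x_2,\dots]]$). -}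

module Defs where

open import Level using (Level)
open import Data.Bool.Base using (Bool; true; false; _∧_; if_then_else_)
open import Data.Nat.Base using (ℕ; zero; suc)
open import Data.Nat using (_≤?_; _<?_) renaming (_≟_ to _≟ℕ_)
open import Data.Fin.Base as Fin using ()
open import Data.Fin.Base using (Fin; toℕ; inject₁)
open import Data.Fin.Properties using () renaming (_≟_ to _≟F_)
open import Data.Fin.Subset using (Subset; inside; outside)
open import Data.Vec.Base using (Vec; []; _∷_; lookup; tabulate)
import Data.Vec.Properties as VecP
open import Data.List.Base using (List; []; _∷_; map; concatMap; foldr; allFin)
open import Relation.Nullary.Decidable using (does)
open import Algebra.Bundles using (CommutativeRing)

allSubsets : (m : ℕ) → List (Subset m)
allSubsets zero    = [] ∷ []
allSubsets (suc m) = concatMap (λ S → (inside ∷ S) ∷ (outside ∷ S) ∷ []) (allSubsets m)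

-- All sequences (i_1,…,i_k) with entries in Fin n  (variable x_{v+1} ↔ v : Fin n).
allSeqs : (n k : ℕ) → List (Vec (Fin n) k)
allSeqs n zero    = [] ∷ []
allSeqs n (suc k) = concatMap (λ v → map (v ∷_) (allSeqs n k)) (allFin n)

allB : {m : ℕ} → (Fin m → Bool) → Bool
allB {m} P = foldr (λ j b → P j ∧ b) true (allFin m)

-- Sequences of length s = suc m; position j : Fin m stands for j+1 ∈ [s-1],
-- comparing i_{j+1} (index inject₁ j) and i_{j+2} (index suc j) in 1-based terms.
weaklyIncr : {n m : ℕ} → Vec (Fin n) (suc m) → Bool
weaklyIncr i = allB (λ j → does (toℕ (lookup i (inject₁ j)) ≤? toℕ (lookup i (Fin.suc j))))

strictOn : {n m : ℕ} → Subset m → Vec (Fin n) (suc m) → Bool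
strictOn J i = allB (λ j → if lookup J j
  then does (toℕ (lookup i (inject₁ j)) <? toℕ (lookup i (Fin.suc j))) else true)

equalOn : {n m : ℕ} → Subset m → Vec (Fin n) (suc m) → Bool
equalOn I i = allB (λ j → if lookup I j
  then does (lookup i (inject₁ j) ≟F lookup i (Fin.suc j)) else true)

mult : {n k : ℕ} → Vec (Fin n) k → Fin n → ℕ
mult []      v = 0
mult (w ∷ i) v = if does (w ≟F v) then suc (mult i v) else mult i v

content : {n k : ℕ} → Vec (Fin n) k → Vec ℕ n
content i = tabulate (mult i)

distinct : {n k : ℕ} → Vec (Fin n) k → ℕ
distinct {n} i = foldr (λ v c → if does (mult i v ≟ℕ 0) then c else suc c) 0 (allFin n)

hasContent : {n k : ℕ} → Vec (Fin n) k → Vec ℕ n → Bool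
hasContent i α = does (VecP.≡-dec _≟ℕ_ (content i) α)

module _ {c ℓ : Level} (R : CommutativeRing c ℓ) where
  open CommutativeRing R

  pow : Carrier → ℕ → Carrier
  pow x zero    = 1#
  pow x (suc k) = x * pow x k

  sumR : {A : Set} → List A → (A → Carrier) → Carrier
  sumR xs f = foldr (λ a r → f a + r) 0# xs

  -- Power series in k[[x_1,x_2,…]] are described by their coefficients:
  -- coefficient of x_1^{α_1} ⋯ x_n^{α_n} for every n and α : Vec ℕ n.
  -- Every sequence contributing to such a monomial uses only x_1..x_n,
  -- so the defining sums restrict exactly to sequences in Fin n.

  -- coefficient of x^α in L_J  (s = suc m, J ⊆ [s-1])
  coeffL : {m : ℕ} → Subset m → {n : ℕ} → Vec ℕ n → Carrier
  coeffL {m} J {n} α = sumR (allSeqs n (suc m)) (λ i →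
    if weaklyIncr i ∧ strictOn J i ∧ hasContent i α then 1# else 0#)

  -- coefficient of x^α in η^{(q)}_I  (s = suc m, I ⊆ [s-1])
  coeffη : Carrier → {m : ℕ} → Subset m → {n : ℕ} → Vec ℕ n → Carrier
  coeffη q {m} I {n} α = sumR (allSeqs n (suc m)) (λ i →
    if weaklyIncr i ∧ equalOn I i ∧ hasContent i α then pow (q + 1#) (distinct i) else 0#)

-- Fix a weakly increasing sequence i and let E ⊆ [s-1] be its set of plateaus, the positions j
-- with i_j = i_{j+1}. Then i contributes to L_J iff J ∩ E = ∅, to η_I iff I ⊆ E, and
-- |{i_1,…,i_s}| = s - |E|. Cancelling the common factor (q+1)^{s-|E|}, the claim for the monomial
-- of i becomes the subset identity
--   Σ_{I ⊆ E} (-1)^{|I|} (-q)^{|I∖J|} = [J ∩ E = ∅] (q+1)^{|E|},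
-- which holds because the left side factors over positions j ∈ E as 1 - (-q)^{[j ∉ J]}.
module Submission where

open import Defs
open import Level using (Level)
open import Data.Nat.Base using (ℕ; zero; suc; _≤_; _<_)
open import Data.Vec.Base using (Vec; []; _∷_; lookup; head)
open import Data.Fin.Subset using (Subset; ∣_∣; _─_)
open import Algebra.Bundles using (CommutativeRing)

import Data.Nat.Base as ℕ
import Data.Nat.Properties as ℕₚ
open import Data.Nat using (_≤?_; _<?_) renaming (_≟_ to _≟ℕ_)
open import Data.Bool.Base using (Bool; true; false; T; _∧_; not; if_then_else_)
open import Data.Bool.Properties using (T-≡; T-∧; ∧-identityʳ; ∧-zeroʳ)
open import Data.Fin.Base as Fin using (Fin; toℕ; inject₁)
open import Data.Fin.Properties using (toℕ-injective) renaming (_≟_ to _≟F_)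
open import Data.List.Base using (List; []; _∷_; foldr; concatMap; allFin; _++_)
open import Data.List.Properties using (foldr-map; map-tabulate)
open import Data.Product.Base using (_×_; _,_; proj₂; map₁)
open import Function.Base using (_∘_; id)
open import Function.Bundles using (Equivalence)
open import Relation.Nullary.Decidable using (does; yes; no; dec-true; dec-false)
open import Relation.Binary.PropositionalEquality using (_≡_; refl; sym; trans; cong; cong₂; subst)
open import Data.Empty using (⊥-elim)

foldr-allFin-suc : {B : Set} {m : ℕ} (k : Fin (suc m) → B → B) (z : B) →
  foldr k z (allFin (suc m)) ≡ k Fin.zero (foldr (k ∘ Fin.suc) z (allFin m))
foldr-allFin-suc {m = m} k z =
  cong (k Fin.zero) (trans (cong (foldr k z) (sym (map-tabulate id Fin.suc))) (foldr-map k Fin.suc z (allFin m)))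

allB-suc : {m : ℕ} (P : Fin (suc m) → Bool) → allB P ≡ (P Fin.zero ∧ allB (P ∘ Fin.suc))
allB-suc P = foldr-allFin-suc (λ j b → P j ∧ b) true

allAdjacent : {n m : ℕ} → (Fin m → Fin n → Fin n → Bool) → Vec (Fin n) (suc m) → Bool
allAdjacent t i = allB (λ j → t j (lookup i (inject₁ j)) (lookup i (Fin.suc j)))

allAdjacent-∷∷ : {n m : ℕ} (t : Fin (suc m) → Fin n → Fin n → Bool) (a b : Fin n) (r : Vec (Fin n) m) →
  allAdjacent t (a ∷ b ∷ r) ≡ (t Fin.zero a b ∧ allAdjacent (t ∘ Fin.suc) (b ∷ r))
allAdjacent-∷∷ t a b r =
  allB-suc (λ j → t j (lookup (a ∷ b ∷ r) (inject₁ j)) (lookup (a ∷ b ∷ r) (Fin.suc j)))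

_⊆ᵇ_ : {m : ℕ} → Subset m → Subset m → Bool
[]      ⊆ᵇ []      = true
(x ∷ p) ⊆ᵇ (y ∷ r) = (if x then y else true) ∧ p ⊆ᵇ r

disjointᵇ : {m : ℕ} → Subset m → Subset m → Bool
disjointᵇ []      []      = true
disjointᵇ (x ∷ p) (y ∷ r) = (if x then not y else true) ∧ disjointᵇ p r

plateaus : {n m : ℕ} → Vec (Fin n) (suc m) → Subset m
plateaus (a ∷ [])    = []
plateaus (a ∷ b ∷ r) = does (a ≟F b) ∷ plateaus (b ∷ r)

weaklyIncr-∷∷ : {n m : ℕ} (a b : Fin n) (r : Vec (Fin n) m) →
  T (weaklyIncr (a ∷ b ∷ r)) → toℕ a ≤ toℕ b × T (weaklyIncr (b ∷ r))
weaklyIncr-∷∷ a b r w =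
  map₁ (ℕₚ.≤ᵇ⇒≤ (toℕ a) (toℕ b))
    (Equivalence.to T-∧ (subst T (allAdjacent-∷∷ (λ _ x y → does (toℕ x ≤? toℕ y)) a b r) w))

equalOn≡⊆ᵇplateaus : {n m : ℕ} (I : Subset m) (i : Vec (Fin n) (suc m)) → equalOn I i ≡ I ⊆ᵇ plateaus i
equalOn≡⊆ᵇplateaus []      (a ∷ [])    = refl
equalOn≡⊆ᵇplateaus (x ∷ I) (a ∷ b ∷ r) =
  trans (allAdjacent-∷∷ (λ j y z → if lookup (x ∷ I) j then does (y ≟F z) else true) a b r)
    (cong (_ ∧_) (equalOn≡⊆ᵇplateaus I (b ∷ r)))

<ᵇ≡≢ᵇ : {n : ℕ} (a b : Fin n) → toℕ a ≤ toℕ b → does (toℕ a <? toℕ b) ≡ not (does (a ≟F b))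
<ᵇ≡≢ᵇ a b a≤b with a ≟F b
... | yes refl = dec-false (toℕ a <? toℕ a) (ℕₚ.<-irrefl refl)
... | no a≢b   = dec-true (toℕ a <? toℕ b) (ℕₚ.≤∧≢⇒< a≤b (a≢b ∘ toℕ-injective))

strictOn≡disjointᵇplateaus : {n m : ℕ} (J : Subset m) (i : Vec (Fin n) (suc m)) → T (weaklyIncr i) →
  strictOn J i ≡ disjointᵇ J (plateaus i)
strictOn≡disjointᵇplateaus []      (a ∷ [])    _ = refl
strictOn≡disjointᵇplateaus (x ∷ J) (a ∷ b ∷ r) w with weaklyIncr-∷∷ a b r w
... | a≤b , w′ =
  trans (allAdjacent-∷∷ (λ j y z → if lookup (x ∷ J) j then does (toℕ y <? toℕ z) else true) a b r)
    (cong₂ _∧_ (cong (λ y → if x then y else true) (<ᵇ≡≢ᵇ a b a≤b)) (strictOn≡disjointᵇplateaus J (b ∷ r) w′))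

countFalse : {n : ℕ} → (Fin n → Bool) → ℕ
countFalse {n} Q = foldr (λ v c → if Q v then c else suc c) 0 (allFin n)

countFalse-cong : {n : ℕ} (P Q : Fin n → Bool) → (∀ v → P v ≡ Q v) → countFalse P ≡ countFalse Q
countFalse-cong {n} P Q P≗Q = go (allFin n)
  where
  go : (vs : List (Fin n)) →
    foldr (λ v c → if P v then c else suc c) 0 vs ≡ foldr (λ v c → if Q v then c else suc c) 0 vs
  go []       = refl
  go (v ∷ vs) rewrite P≗Q v | go vs = refl

countFalse-suc : {n : ℕ} (Q : Fin (suc n) → Bool) →
  countFalse Q ≡ (if Q Fin.zero then countFalse (Q ∘ Fin.suc) else suc (countFalse (Q ∘ Fin.suc)))
countFalse-suc Q = foldr-allFin-suc (λ v c → if Q v then c else suc c) 0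

countFalse-true : (n : ℕ) → countFalse {n} (λ _ → true) ≡ 0
countFalse-true zero    = refl
countFalse-true (suc n) = trans (countFalse-suc {n} (λ _ → true)) (countFalse-true n)

countFalse-remove : {n : ℕ} (Q : Fin n → Bool) (a : Fin n) →
  countFalse (λ v → if does (a ≟F v) then false else Q v) ≡ (if Q a then suc (countFalse Q) else countFalse Q)
countFalse-remove {suc n} Q Fin.zero
  rewrite countFalse-suc (λ v → if does (Fin.zero ≟F v) then false else Q v) | countFalse-suc Q
  with Q Fin.zero
... | true  = refl
... | false = refl
countFalse-remove {suc n} Q (Fin.suc a)
  rewrite countFalse-suc (λ v → if does (Fin.suc a ≟F v) then false else Q v) | countFalse-suc Q
        | countFalse-remove (Q ∘ Fin.suc) a
  with Q Fin.zero | Q (Fin.suc a)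
... | true  | true  = refl
... | true  | false = refl
... | false | true  = refl
... | false | false = refl

absent : {n k : ℕ} → Vec (Fin n) k → Fin n → Bool
absent i v = does (mult i v ≟ℕ 0)

absent-∷ : {n k : ℕ} (a : Fin n) (i : Vec (Fin n) k) (v : Fin n) →
  absent (a ∷ i) v ≡ (if does (a ≟F v) then false else absent i v)
absent-∷ a i v with a ≟F v
... | yes _ = refl
... | no _  = refl

absent-head : {n k : ℕ} (a : Fin n) (r : Vec (Fin n) k) → absent (a ∷ r) a ≡ false
absent-head a r with a ≟F a
... | yes _ = refl
... | no a≢a = ⊥-elim (a≢a refl)

absent-below-head : {n m : ℕ} (i : Vec (Fin n) (suc m)) → T (weaklyIncr i) →
  (v : Fin n) → toℕ v < toℕ (head i) → absent i v ≡ true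
absent-below-head (b ∷ r) w v v<b with b ≟F v
absent-below-head (b ∷ r)     w .b v<b | yes refl = ⊥-elim (ℕₚ.<-irrefl refl v<b)
absent-below-head (b ∷ [])    w v  v<b | no _     = refl
absent-below-head (b ∷ c ∷ r) w v  v<b | no _ with weaklyIncr-∷∷ b c r w
... | b≤c , w′ = absent-below-head (c ∷ r) w′ v (ℕₚ.<-≤-trans v<b b≤c)

distinct-∷ : {n k : ℕ} (a : Fin n) (i : Vec (Fin n) k) →
  distinct (a ∷ i) ≡ (if absent i a then suc (distinct i) else distinct i)
distinct-∷ a i = trans (countFalse-cong _ _ (absent-∷ a i)) (countFalse-remove (absent i) a)

-- Each plateau is a repeated value; every other step of a weakly increasing sequence is a new one.
distinct+∣plateaus∣ : {n m : ℕ} (i : Vec (Fin n) (suc m)) → T (weaklyIncr i) →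
  distinct i ℕ.+ ∣ plateaus i ∣ ≡ suc m
distinct+∣plateaus∣ {n} (a ∷ []) _ rewrite distinct-∷ a ([] {A = Fin n}) =
  cong suc (trans (ℕₚ.+-identityʳ _) (countFalse-true n))
distinct+∣plateaus∣ {m = suc m} (a ∷ b ∷ r) w rewrite distinct-∷ a (b ∷ r) with a ≟F b
... | yes refl rewrite absent-head a r =
  trans (ℕₚ.+-suc (distinct (a ∷ r)) _)
    (cong suc (distinct+∣plateaus∣ (a ∷ r) (proj₂ (weaklyIncr-∷∷ a a r w))))
... | no a≢b with weaklyIncr-∷∷ a b r w
...   | a≤b , w′ rewrite absent-below-head (b ∷ r) w′ a (ℕₚ.≤∧≢⇒< a≤b (a≢b ∘ toℕ-injective)) =
  cong suc (distinct+∣plateaus∣ (b ∷ r) w′)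

module Expansion {c ℓ : Level} (R : CommutativeRing c ℓ) (q : CommutativeRing.Carrier R) where
  open CommutativeRing R renaming (refl to ≈-refl; sym to ≈-sym; trans to ≈-trans)
  open import Algebra.Properties.Ring ring using (-1*x≈-x; -‿distribˡ-*; -‿distribʳ-*; -‿involutive)
  open import Algebra.Properties.CommutativeSemigroup *-commutativeSemigroup using (x∙yz≈y∙xz)
  open import Relation.Binary.Reasoning.Setoid setoid

  infix 5 _when_
  _when_ : Carrier → Bool → Carrier
  x when b = if b then x else 0#

  ∑ : {A : Set} → List A → (A → Carrier) → Carrier
  ∑ = sumR R

  ∑-cong : {A : Set} (xs : List A) {f g : A → Carrier} → (∀ a → f a ≈ g a) → ∑ xs f ≈ ∑ xs g
  ∑-cong []       f≈g = ≈-refl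
  ∑-cong (x ∷ xs) f≈g = +-cong (f≈g x) (∑-cong xs f≈g)

  ∑-zero : {A : Set} (xs : List A) {f : A → Carrier} → (∀ a → f a ≈ 0#) → ∑ xs f ≈ 0#
  ∑-zero []       f≈0 = ≈-refl
  ∑-zero (x ∷ xs) f≈0 = ≈-trans (+-cong (f≈0 x) (∑-zero xs f≈0)) (+-identityʳ 0#)

  *-distribˡ-∑ : {A : Set} (xs : List A) (k : Carrier) (f : A → Carrier) → k * ∑ xs f ≈ ∑ xs (λ a → k * f a)
  *-distribˡ-∑ []       k f = zeroʳ k
  *-distribˡ-∑ (x ∷ xs) k f = ≈-trans (distribˡ k (f x) (∑ xs f)) (+-cong ≈-refl (*-distribˡ-∑ xs k f))

  ∑-+ : {A : Set} (xs : List A) (f g : A → Carrier) → ∑ xs (λ a → f a + g a) ≈ ∑ xs f + ∑ xs g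
  ∑-+ []       f g = ≈-sym (+-identityʳ 0#)
  ∑-+ (x ∷ xs) f g = begin
    (f x + g x) + ∑ xs (λ a → f a + g a) ≈⟨ +-cong ≈-refl (∑-+ xs f g) ⟩
    (f x + g x) + (∑ xs f + ∑ xs g)      ≈⟨ +-assoc (f x) (g x) _ ⟩
    f x + (g x + (∑ xs f + ∑ xs g))      ≈⟨ +-cong ≈-refl (≈-sym (+-assoc (g x) _ _)) ⟩
    f x + ((g x + ∑ xs f) + ∑ xs g)      ≈⟨ +-cong ≈-refl (+-cong (+-comm (g x) _) ≈-refl) ⟩
    f x + ((∑ xs f + g x) + ∑ xs g)      ≈⟨ +-cong ≈-refl (+-assoc _ (g x) _) ⟩
    f x + (∑ xs f + (g x + ∑ xs g))      ≈⟨ ≈-sym (+-assoc (f x) _ _) ⟩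
    (f x + ∑ xs f) + (g x + ∑ xs g)      ∎

  ∑-swap : {A B : Set} (xs : List A) (ys : List B) (f : A → B → Carrier) →
    ∑ xs (λ a → ∑ ys (f a)) ≈ ∑ ys (λ b → ∑ xs (λ a → f a b))
  ∑-swap []       ys f = ≈-sym (∑-zero ys (λ _ → ≈-refl))
  ∑-swap (x ∷ xs) ys f =
    ≈-trans (+-cong ≈-refl (∑-swap xs ys f)) (≈-sym (∑-+ ys (f x) (λ b → ∑ xs (λ a → f a b))))

  ∑-++ : {A : Set} (xs ys : List A) (f : A → Carrier) → ∑ (xs ++ ys) f ≈ ∑ xs f + ∑ ys f
  ∑-++ []       ys f = ≈-sym (+-identityˡ _)
  ∑-++ (x ∷ xs) ys f = ≈-trans (+-cong ≈-refl (∑-++ xs ys f)) (≈-sym (+-assoc _ _ _))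

  ∑-concatMap : {A B : Set} (g : A → List B) (xs : List A) (f : B → Carrier) →
    ∑ (concatMap g xs) f ≈ ∑ xs (λ a → ∑ (g a) f)
  ∑-concatMap g []       f = ≈-refl
  ∑-concatMap g (x ∷ xs) f = ≈-trans (∑-++ (g x) (concatMap g xs) f) (+-cong ≈-refl (∑-concatMap g xs f))

  pow-+ : (x : Carrier) (a b : ℕ) → pow R x (a ℕ.+ b) ≈ pow R x a * pow R x b
  pow-+ x zero    b = ≈-sym (*-identityˡ _)
  pow-+ x (suc a) b = ≈-trans (*-cong ≈-refl (pow-+ x a b)) (≈-sym (*-assoc _ _ _))

  *-when : (k x : Carrier) (b : Bool) → k * (x when b) ≈ (k * x) when b
  *-when k x true  = ≈-refl
  *-when k x false = zeroʳ k

  when-cong : {x y : Carrier} (b : Bool) → x ≈ y → x when b ≈ y when b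
  when-cong true  x≈y = x≈y
  when-cong false x≈y = ≈-refl

  *-when-1# : (k w : Carrier) (b : Bool) → k * (w * (1# when b)) ≈ w * (k when b)
  *-when-1# k w true  = ≈-trans (*-cong ≈-refl (*-identityʳ w)) (*-comm k w)
  *-when-1# k w false = ≈-trans (*-cong ≈-refl (zeroʳ w)) (≈-trans (zeroʳ k) (≈-sym (zeroʳ w)))

  q+1^ : ℕ → Carrier
  q+1^ = pow R (q + 1#)

  weight : {m : ℕ} → Subset m → Subset m → Carrier
  weight J I = pow R (- 1#) ∣ I ∣ * pow R (- q) ∣ I ─ J ∣

  term : {m : ℕ} → Subset m → Subset m → Subset m → Carrier
  term J E I = weight J I * (1# when I ⊆ᵇ E)

  -- positionFactor [j ∈ J] [j ∈ E] is 1 if j ∉ E, and 1 - (-q)^{[j ∉ J]} if j ∈ E.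
  positionFactor : Bool → Bool → Carrier
  positionFactor j     false = 1#
  positionFactor true  true  = 0#
  positionFactor false true  = q + 1#

  pull-out-sign : (a b A : Carrier) → ((- 1# * a) * b) * A ≈ - ((a * b) * A)
  pull-out-sign a b A = ≈-trans (*-cong (*-assoc (- 1#) a b) ≈-refl) (≈-trans (*-assoc (- 1#) _ A) (-1*x≈-x _))

  drop-zero-summand : (X Y : Carrier) → X * 0# + (Y + 0#) ≈ 1# * Y
  drop-zero-summand X Y =
    ≈-trans (+-cong (zeroʳ X) (+-identityʳ Y)) (≈-trans (+-identityˡ Y) (≈-sym (*-identityˡ Y)))

  term-true∷+term-false∷ : {m : ℕ} (j e : Bool) (J E S : Subset m) →
    term (j ∷ J) (e ∷ E) (true ∷ S) + (term (j ∷ J) (e ∷ E) (false ∷ S) + 0#) ≈ positionFactor j e * term J E S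
  term-true∷+term-false∷ true  false J E S = drop-zero-summand _ _
  term-true∷+term-false∷ false false J E S = drop-zero-summand _ _
  term-true∷+term-false∷ true  true  J E S = begin
    ((- 1# * a) * b) * A + ((a * b) * A + 0#) ≈⟨ +-cong (pull-out-sign a b A) (+-identityʳ _) ⟩
    - ((a * b) * A) + (a * b) * A              ≈⟨ -‿inverseˡ _ ⟩
    0#                                         ≈⟨ ≈-sym (zeroˡ _) ⟩
    0# * ((a * b) * A)                         ∎
    where a = pow R (- 1#) ∣ S ∣; b = pow R (- q) ∣ S ─ J ∣; A = 1# when S ⊆ᵇ E
  term-true∷+term-false∷ false true  J E S = begin
    ((- 1# * a) * ((- q) * b)) * A + (Y + 0#) ≈⟨ +-cong scaled (+-identityʳ Y) ⟩
    q * Y + Y                                 ≈⟨ +-cong ≈-refl (≈-sym (*-identityˡ Y)) ⟩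
    q * Y + 1# * Y                            ≈⟨ ≈-sym (distribʳ Y q 1#) ⟩
    (q + 1#) * Y                              ∎
    where
    a = pow R (- 1#) ∣ S ∣; b = pow R (- q) ∣ S ─ J ∣; A = 1# when S ⊆ᵇ E
    Y = (a * b) * A
    scaled : ((- 1# * a) * ((- q) * b)) * A ≈ q * Y
    scaled = begin
      ((- 1# * a) * ((- q) * b)) * A ≈⟨ *-cong (x∙yz≈y∙xz (- 1# * a) (- q) b) ≈-refl ⟩
      ((- q) * ((- 1# * a) * b)) * A ≈⟨ *-assoc (- q) _ A ⟩
      (- q) * (((- 1# * a) * b) * A) ≈⟨ *-cong ≈-refl (pull-out-sign a b A) ⟩
      (- q) * (- Y)                  ≈⟨ ≈-sym (-‿distribˡ-* q (- Y)) ⟩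
      - (q * (- Y))                  ≈⟨ -‿cong (≈-sym (-‿distribʳ-* q Y)) ⟩
      - (- (q * Y))                  ≈⟨ -‿involutive _ ⟩
      q * Y                          ∎

  positionFactor-absorb : {m : ℕ} (j e : Bool) (J E : Subset m) →
    positionFactor j e * (q+1^ ∣ E ∣ when disjointᵇ J E)
      ≈ q+1^ ∣ e ∷ E ∣ when disjointᵇ (j ∷ J) (e ∷ E)
  positionFactor-absorb true  false J E = *-identityˡ _
  positionFactor-absorb false false J E = *-identityˡ _
  positionFactor-absorb true  true  J E = zeroˡ _
  positionFactor-absorb false true  J E = *-when (q + 1#) _ (disjointᵇ J E)

  alternating-∑-⊆ : {m : ℕ} (J E : Subset m) →
    ∑ (allSubsets m) (term J E) ≈ q+1^ ∣ E ∣ when disjointᵇ J E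
  alternating-∑-⊆ []      []      = ≈-trans (+-identityʳ _) (≈-trans (*-identityʳ _) (*-identityʳ _))
  alternating-∑-⊆ {suc m} (j ∷ J) (e ∷ E) = begin
    ∑ (allSubsets (suc m)) (term (j ∷ J) (e ∷ E))
      ≈⟨ ∑-concatMap (λ S → (true ∷ S) ∷ (false ∷ S) ∷ []) (allSubsets m) _ ⟩
    ∑ (allSubsets m) (λ S → term (j ∷ J) (e ∷ E) (true ∷ S) + (term (j ∷ J) (e ∷ E) (false ∷ S) + 0#))
      ≈⟨ ∑-cong (allSubsets m) (term-true∷+term-false∷ j e J E) ⟩
    ∑ (allSubsets m) (λ S → positionFactor j e * term J E S)
      ≈⟨ ≈-sym (*-distribˡ-∑ (allSubsets m) _ _) ⟩
    positionFactor j e * ∑ (allSubsets m) (term J E)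
      ≈⟨ *-cong ≈-refl (alternating-∑-⊆ J E) ⟩
    positionFactor j e * (q+1^ ∣ E ∣ when disjointᵇ J E)
      ≈⟨ positionFactor-absorb j e J E ⟩
    q+1^ ∣ e ∷ E ∣ when disjointᵇ (j ∷ J) (e ∷ E) ∎

  guard-both-sides : {A : Set} (xs : List A) (k x : Carrier) (w : A → Carrier) (s h : Bool) (e : A → Bool) →
    k * (1# when s) ≈ ∑ xs (λ a → w a * (x when e a)) →
    k * (1# when (s ∧ h)) ≈ ∑ xs (λ a → w a * (x when (e a ∧ h)))
  guard-both-sides xs k x w s true  e eq = begin
    k * (1# when (s ∧ true))                   ≡⟨ cong (λ b → k * (1# when b)) (∧-identityʳ s) ⟩
    k * (1# when s)                            ≈⟨ eq ⟩
    ∑ xs (λ a → w a * (x when e a))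
      ≈⟨ ∑-cong xs (λ a → reflexive (cong (λ b → w a * (x when b)) (∧-identityʳ (e a)))) ⟨
    ∑ xs (λ a → w a * (x when (e a ∧ true)))   ∎
  guard-both-sides xs k x w s false e eq = begin
    k * (1# when (s ∧ false))                  ≡⟨ cong (λ b → k * (1# when b)) (∧-zeroʳ s) ⟩
    k * 0#                                     ≈⟨ zeroʳ k ⟩
    0#
      ≈⟨ ∑-zero xs (λ a → ≈-trans (reflexive (cong (λ b → w a * (x when b)) (∧-zeroʳ (e a)))) (zeroʳ (w a))) ⟨
    ∑ xs (λ a → w a * (x when (e a ∧ false)))  ∎

  module _ {m : ℕ} (J : Subset m) where
    monomial-identity : {n : ℕ} (i : Vec (Fin n) (suc m)) → T (weaklyIncr i) →
      q+1^ (suc m) * (1# when strictOn J i)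
        ≈ ∑ (allSubsets m) (λ I → weight J I * (q+1^ (distinct i) when equalOn I i))
    monomial-identity i w = begin
      q+1^ (suc m) * (1# when strictOn J i)
        ≡⟨ cong (λ b → q+1^ (suc m) * (1# when b)) (strictOn≡disjointᵇplateaus J i w) ⟩
      q+1^ (suc m) * (1# when disjointᵇ J E)
        ≈⟨ *-when (q+1^ (suc m)) 1# (disjointᵇ J E) ⟩
      q+1^ (suc m) * 1# when disjointᵇ J E
        ≈⟨ when-cong (disjointᵇ J E) (≈-trans (*-identityʳ _) exponent-split) ⟩
      P * Q when disjointᵇ J E
        ≈⟨ *-when P Q (disjointᵇ J E) ⟨
      P * (Q when disjointᵇ J E)
        ≈⟨ *-cong ≈-refl (alternating-∑-⊆ J E) ⟨
      P * ∑ (allSubsets m) (term J E)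
        ≈⟨ *-distribˡ-∑ (allSubsets m) P (term J E) ⟩
      ∑ (allSubsets m) (λ I → P * term J E I)
        ≈⟨ ∑-cong (allSubsets m) (λ I → *-when-1# P (weight J I) (I ⊆ᵇ E)) ⟩
      ∑ (allSubsets m) (λ I → weight J I * (P when I ⊆ᵇ E))
        ≈⟨ ∑-cong (allSubsets m) (λ I → reflexive (cong (λ b → weight J I * (P when b)) (equalOn≡⊆ᵇplateaus I i))) ⟨
      ∑ (allSubsets m) (λ I → weight J I * (P when equalOn I i)) ∎
      where
      E = plateaus i
      P = q+1^ (distinct i)
      Q = q+1^ ∣ E ∣
      exponent-split : q+1^ (suc m) ≈ P * Q
      exponent-split =
        ≈-trans (reflexive (cong q+1^ (sym (distinct+∣plateaus∣ i w)))) (pow-+ _ (distinct i) ∣ E ∣)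

    coefficient-identity : {n : ℕ} (α : Vec ℕ n) (i : Vec (Fin n) (suc m)) →
      q+1^ (suc m) * (1# when (weaklyIncr i ∧ strictOn J i ∧ hasContent i α))
        ≈ ∑ (allSubsets m) (λ I → weight J I * (q+1^ (distinct i) when (weaklyIncr i ∧ equalOn I i ∧ hasContent i α)))
    coefficient-identity α i with weaklyIncr i in incr
    ... | false = ≈-trans (zeroʳ _) (≈-sym (∑-zero (allSubsets m) (λ I → zeroʳ (weight J I))))
    ... | true  = guard-both-sides (allSubsets m) _ (q+1^ (distinct i)) (weight J) (strictOn J i) (hasContent i α)
                    (λ I → equalOn I i) (monomial-identity i (Equivalence.from T-≡ incr))

proposition3p9 : {c ℓ : Level} (R : CommutativeRing c ℓ) (q : CommutativeRing.Carrier R)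
    (m : ℕ) (J : Subset m) (n : ℕ) (α : Vec ℕ n) →
    let open CommutativeRing R in
    pow R (q + 1#) (suc m) * coeffL R J α
      ≈ sumR R (allSubsets m) (λ I →
          (pow R (- 1#) ∣ I ∣ * pow R (- q) ∣ I ─ J ∣) * coeffη R q I α)
proposition3p9 R q m J n α = begin
  q+1^ (suc m) * ∑ seqs (λ i → 1# when (weaklyIncr i ∧ strictOn J i ∧ hasContent i α))
    ≈⟨ *-distribˡ-∑ seqs _ _ ⟩
  ∑ seqs (λ i → q+1^ (suc m) * (1# when (weaklyIncr i ∧ strictOn J i ∧ hasContent i α)))
    ≈⟨ ∑-cong seqs (coefficient-identity J α) ⟩
  ∑ seqs (λ i → ∑ subsets (λ I → weight J I * ηTerm I i))
    ≈⟨ ∑-swap seqs subsets _ ⟩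
  ∑ subsets (λ I → ∑ seqs (λ i → weight J I * ηTerm I i))
    ≈⟨ ∑-cong subsets (λ I → *-distribˡ-∑ seqs (weight J I) (ηTerm I)) ⟨
  ∑ subsets (λ I → weight J I * coeffη R q I α) ∎
  where
  open CommutativeRing R using (Carrier; setoid; 1#; _*_)
  open Expansion R q
  open import Relation.Binary.Reasoning.Setoid setoid
  seqs = allSeqs n (suc m)
  subsets = allSubsets m
  ηTerm : Subset m → Vec (Fin n) (suc m) → Carrier
  ηTerm I i = q+1^ (distinct i) when (weaklyIncr i ∧ equalOn I i ∧ hasContent i α)
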